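{- Let $m\ge 3$ be odd and $n\ge 1$. Run Algorithm ODD (described in the context) with $n$ disks and $m$ pegs, and record after the initialization and after every single-step move of any disk the tuple $(a_n,\dots,a_1)$, where $a_i\in\{0,\dots,m-1\}$ is the index of the peg on which disk $D_i$ lies. Then the sequence of recorded tuples is exactly the $m$-ary reflected Gray code $G_n$ of length $n$.
   Context: Disks $D_1,\dots,D_n$ have increasing sizes; pegs $P_0,\dots,P_{m-1}$ are arranged in a row, and a single step moves a disk from $P_i$ to an adjacent peg $P_{i\pm1}$, putting it on top of that peg's stack. Algorithm ODD: Initially all disks are on $P_0$. Then repeat: (i) move $D_1$ step by step for $m-1$ steps, from $P_0$ to $P_{m-1}$ if it is on $P_0$, or from $P_{m-1}$ to $P_0$ if it is on $P_{m-1}$; (ii) among the topmost disks of the $m-1$ pegs that do not carry $D_1$, let $D_k$ be the smallest; if there is no such disk, terminate; (iii) move $D_k$ by one step: if $D_k$ is on $P_0$ or $P_{m-1}$, in the only possible direction; otherwise in the same direction as its previous move. The $m$-ary reflected Gray code $G_n$ is a sequence of $n$-tuples $(a_n,\dots,a_1)$, $0\le a_i<m$, defined recursively: $G_0$ consists of the empty tuple; if $G_n=C_1,C_2,\dots,C_{m^n}$, then $G_{n+1}$ is $C_10,C_11,\dots,C_1(m-1),\ C_2(m-1),C_2(m-2),\dots,C_20,\ C_30,\dots,C_3(m-1),\ C_4(m-1),\dots,C_40,\dots$, i.e. for odd $i$ the tuple $C_i$ is followed by the new rightmost digit running $0,1,\dots,m-1$, and for even $i$ by the new rightmost digit running $m-1,\dots,1,0$;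 here $C_ix$ denotes the tuple whose digits $(a_{n+1},\dots,a_2)$ are those of $C_i$ and whose last digit $a_1$ is $x$. -}

module Defs where

open import Data.Nat using (ℕ; zero; suc; _<?_; _≡ᵇ_; _<ᵇ_; s≤s)
open import Data.Fin using (Fin; zero; suc; toℕ; fromℕ<; inject₁)
open import Data.Fin.Properties using () renaming (_≟_ to _≟F_)
open import Data.Bool using (Bool; true; false; if_then_else_)
open import Data.List using (List; []; _∷_; _++_; filter; concat; reverse; allFin)
  renaming (map to mapL)
open import Data.Vec using (Vec; []; _∷ʳ_; tabulate) renaming (reverse to reverseV)
open import Data.Maybe using (Maybe; just; nothing) renaming (map to mapM)
open import Data.Product using (_×_; _,_)
open import Relation.Nullary using (yes; no; ¬?)

-- The m-ary reflected Gray code G_n.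
-- A tuple (a_n, …, a_1) is a Vec (Fin m) n whose FIRST entry is a_n and
-- whose LAST entry is a_1.

upDigits : (m : ℕ) → List (Fin m)
upDigits m = allFin m

downDigits : (m : ℕ) → List (Fin m)
downDigits m = reverse (allFin m)

extendGray : (m : ℕ) {n : ℕ} → Bool → List (Vec (Fin m) n) → List (Vec (Fin m) (suc n))
extendGray m true  []       = []
extendGray m false []       = []
extendGray m true  (c ∷ cs) = mapL (c ∷ʳ_) (upDigits m)   ++ extendGray m false cs
extendGray m false (c ∷ cs) = mapL (c ∷ʳ_) (downDigits m) ++ extendGray m true cs

gray : (m n : ℕ) → List (Vec (Fin m) n)
gray m zero    = [] ∷ []
gray m (suc n) = extendGray m true (gray m n)

-- Algorithm ODD with M = suc m' pegs P_0 … P_{m'} and N = suc n' disks.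
-- Disk D_{i+1} is represented by i : Fin N (so D_1 = zero).

module ODD (m' n' : ℕ) where
  M N : ℕ
  M = suc m'
  N = suc n'

  Peg Disk : Set
  Peg = Fin M
  Disk = Fin N

  -- state: position of every disk, the stack on every peg (head = top),
  -- and the direction of each disk's previous move (true = towards P_{m-1})
  record State : Set where
    field
      pos   : Disk → Peg
      stack : Peg → List Disk
      dir   : Disk → Bool
  open State

  tuple : State → Vec Peg N
  tuple s = reverseV (tabulate (pos s))

  -- one step to an adjacent peg (true: P_i → P_{i+1}, false: P_i → P_{i-1});
  -- at the boundary where no such peg exists the peg is left unchanged
  -- (never happens in the algorithm).
  stepPeg : Bool → Peg → Peg
  stepPeg true  p with toℕ p <? m'
  ... | yes lt = fromℕ< (s≤s lt)
  ... | no  _  = p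
  stepPeg false zero    = zero
  stepPeg false (suc q) = inject₁ q

  removeDisk : Disk → List Disk → List Disk
  removeDisk d = filter (λ x → ¬? (x ≟F d))

  move : State → Disk → Bool → State
  move s d b = record
    { pos   = λ e → if isYes (e ≟F d) then q else pos s e
    ; stack = λ r → let base = if isYes (r ≟F p) then removeDisk d (stack s r) else stack s r
                    in if isYes (r ≟F q) then d ∷ base else base
    ; dir   = λ e → if isYes (e ≟F d) then b else dir s e
    }
    where
      open import Relation.Nullary.Decidable using (isYes)
      p = pos s d
      q = stepPeg b p

  walk : ℕ → Bool → State → List (Vec Peg N) × State
  walk zero    b s = [] , s
  walk (suc k) b s with walk k b (move s zero b)
  ... | xs , s'' = tuple (move s zero b) ∷ xs , s''

  minDisk : List Disk → Maybe Disk
  minDisk []       = nothing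
  minDisk (d ∷ ds) with minDisk ds
  ... | nothing = just d
  ... | just e  = just (if toℕ d <ᵇ toℕ e then d else e)

  topsWithoutD1 : State → List Disk
  topsWithoutD1 s = concat (mapL f (allFin M))
    where
      open import Relation.Nullary.Decidable using (isYes)
      f : Peg → List Disk
      f r with isYes (r ≟F pos s zero) | stack s r
      ... | true  | _      = []
      ... | false | []     = []
      ... | false | d ∷ _  = d ∷ []

  dirFor : State → Disk → Bool
  dirFor s d with toℕ (pos s d) ≡ᵇ 0 | toℕ (pos s d) ≡ᵇ m'
  ... | true  | _     = true
  ... | false | true  = false
  ... | false | false = dir s d

  -- the main loop, with fuel counting rounds; nothing = fuel exhausted
  loop : ℕ → State → Maybe (List (Vec Peg N))
  loop zero    s = nothing
  loop (suc f) s with walk m' (toℕ (pos s zero) ≡ᵇ 0) s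
  ... | xs , s1 with minDisk (topsWithoutD1 s1)
  ...   | nothing = just xs
  ...   | just d  = mapM (λ ys → xs ++ (tuple (move s1 d (dirFor s1 d)) ∷ ys))
                         (loop f (move s1 d (dirFor s1 d)))

  initial : State
  initial = record
    { pos   = λ _ → zero
    ; stack = λ { zero → allFin N ; (suc _) → [] }
    ; dir   = λ _ → true
    }

  run : ℕ → Maybe (List (Vec Peg N))
  run f = mapM (tuple initial ∷_) (loop f initial)

-- Recorded sequence of Algorithm ODD with m pegs and n disks, given fuel
-- (number of rounds); nothing if the algorithm has not terminated within
-- the fuel (or if m = 0 or n = 0, cases excluded by the theorem).
oddRun : (m n : ℕ) → ℕ → Maybe (List (Vec (Fin m) n))
oddRun zero    n       f = nothing
oddRun (suc m) zero    f = nothing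
oddRun (suc m) (suc n) f = ODD.run m n f

module Submission where

-- Call the parity p of the digit sum of a tuple its phase, and let end p be P_{m-1} for even p
-- and P_0 for odd p.  Since m is odd, both boundary pegs have even index, and G_n obeys a
-- successor rule: the lowest digit not at end p moves one step, upwards iff the digits above it
-- have even sum, and the phase flips.  Algorithm ODD follows this rule.  In each round D_1 sweeps
-- from one boundary peg to the other, one Gray step per move; afterwards D_1 and all disks below
-- the lowest digit D_k off end p lie on end p, so D_k is the smallest top on the other pegs.  It
-- moves in its remembered direction (its higher digits are unchanged since its last move) or, at
-- a boundary peg, in the only possible one.  Parity alone shows that this move stays in the row
-- and does not land on D_1's peg, so the stacks stay sorted.

open import Defs
open import Data.Bool using (Bool; true; false; if_then_else_; T)
open import Data.Empty using (⊥-elim)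
open import Data.Fin using (Fin; zero; suc; toℕ; fromℕ) renaming (_<_ to _<ᶠ_; _≤_ to _≤ᶠ_)
open import Data.Fin.Properties
  using (toℕ-injective; toℕ-fromℕ; toℕ-fromℕ<; toℕ-inject₁; toℕ≤pred[n])
  renaming (_≟_ to _≟F_; suc-injective to suc-injectiveᶠ)
open import Data.List
  using (List; []; _∷_; _++_; concat; length; iterate; applyUpTo; upTo; downFrom; reverse; allFin;
         tabulate)
  renaming (map to mapL)
open import Data.List.Membership.Propositional using (_∈_)
open import Data.List.Membership.Propositional.Properties
  using (∈-filter⁺; ∈-filter⁻; ∈-concat⁺′; ∈-concat⁻′; ∈-map⁺; ∈-map⁻; ∈-allFin)
open import Data.List.Properties
  using (++-identityʳ; map-tabulate; map-injective; reverse-map; reverse-upTo; map-cong; map-∘; map-++)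
open import Data.List.Relation.Unary.All as All using ()
open import Data.List.Relation.Unary.AllPairs using (AllPairs; []; _∷_)
import Data.List.Relation.Unary.AllPairs.Properties as AllPairs
open import Data.List.Relation.Unary.Any using (here; there)
open import Data.List.Relation.Unary.Any.Properties using (¬Any[])
open import Data.Maybe using (Maybe; just; nothing) renaming (map to mapM)
import Data.Maybe.Properties as Maybe
open import Data.Nat
  using (ℕ; zero; suc; _+_; _≤_; _<_; _%_; _≡ᵇ_; _<ᵇ_; _<?_; s≤s; z≤n; NonZero; parity)
open import Data.Nat.Properties
  using (≡ᵇ⇒≡; ≡⇒≡ᵇ; <ᵇ-reflects-<; ≤-refl; ≤-trans; ≤-antisym; <⇒≤; <⇒≱; ≮⇒≥; ≤∧≢⇒<;
         <-irrefl; +-suc; +-identityʳ; m+1+n≢m; suc-injective; 0≢1+n; module ≤-Reasoning)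
open import Data.Parity.Base using (Parity; 0ℙ; 1ℙ; _⁻¹) renaming (_+_ to _⊕_)
open import Data.Parity.Properties using (p≢p⁻¹; suc-homo-⁻¹; ⁻¹-selfInverse; ⁻¹-involutive)
open import Data.Product using (_×_; _,_; proj₁; proj₂; ∃-syntax; map₂)
open import Data.Sum using (_⊎_; inj₁; inj₂)
open import Data.Unit using (tt)
open import Data.Vec using (Vec; []; _∷_; lookup; replicate; _[_]%=_; _∷ʳ_)
  renaming (reverse to reverseV)
open import Data.Vec.Properties
  using (lookup-replicate; reverse-∷; tabulate-cong; tabulate∘lookup; lookup∘updateAt;
         lookup∘updateAt′)
open import Function using (_∘_; _∋_; id; const; flip; case_of_)
open import Relation.Nullary using (yes; no; ¬?)
open import Relation.Nullary.Reflects using (ofʸ; ofⁿ)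
open import Relation.Binary.PropositionalEquality

⁻¹-distribˡ-⊕ : ∀ p q → p ⁻¹ ⊕ q ≡ (p ⊕ q) ⁻¹
⁻¹-distribˡ-⊕ 0ℙ q = refl
⁻¹-distribˡ-⊕ 1ℙ q = sym (⁻¹-involutive q)

⁻¹-distribʳ-⊕ : ∀ p q → p ⊕ q ⁻¹ ≡ (p ⊕ q) ⁻¹
⁻¹-distribʳ-⊕ 0ℙ q = refl
⁻¹-distribʳ-⊕ 1ℙ q = refl

parity-suc : ∀ n → parity (suc n) ≡ parity n ⁻¹
parity-suc n = sym (⁻¹-selfInverse (suc-homo-⁻¹ n))

suc%2≡1⇒parity≡0ℙ : ∀ n → suc n % 2 ≡ 1 → parity n ≡ 0ℙ
suc%2≡1⇒parity≡0ℙ zero          _ = refl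
suc%2≡1⇒parity≡0ℙ (suc zero)    ()
suc%2≡1⇒parity≡0ℙ (suc (suc n)) h = suc%2≡1⇒parity≡0ℙ n h

tabulate-∘toℕ : ∀ {A : Set} n (f : ℕ → A) → tabulate {n = n} (f ∘ toℕ) ≡ applyUpTo f n
tabulate-∘toℕ zero    f = refl
tabulate-∘toℕ (suc n) f = cong (f 0 ∷_) (tabulate-∘toℕ n (f ∘ suc))

map-toℕ-allFin : ∀ n → mapL toℕ (allFin n) ≡ upTo n
map-toℕ-allFin n = trans (map-tabulate id toℕ) (tabulate-∘toℕ n id)

sorted-minimum-head : ∀ {n} {x : Fin n} {ds} → AllPairs _<ᶠ_ ds → x ∈ ds →
                      (∀ {e} → e ∈ ds → x ≤ᶠ e) → ∃[ xs ] ds ≡ x ∷ xs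
sorted-minimum-head (_ ∷ _)  (here refl) _  = _ , refl
sorted-minimum-head (d< ∷ _) (there x∈)  x≤ = ⊥-elim (<⇒≱ (All.lookup d< x∈) (x≤ (here refl)))

-- Digit vectors list a tuple lowest digit first: the digits above entry j are the entries after it.
module _ {n : ℕ} where
  Σparity : ∀ {k} → Vec (Fin n) k → Parity
  Σparity []      = 0ℙ
  Σparity (x ∷ c) = parity (toℕ x) ⊕ Σparity c

  parityAbove : ∀ {k} → Vec (Fin n) k → Fin k → Parity
  parityAbove (_ ∷ c) zero    = Σparity c
  parityAbove (_ ∷ c) (suc j) = parityAbove c j

  first≢ : ∀ {k} → Fin n → Vec (Fin n) k → Maybe (Fin k)
  first≢ e []      = nothing
  first≢ e (x ∷ c) with x ≟F e
  ... | yes _ = mapM suc (first≢ e c)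
  ... | no  _ = just zero

  Σparity-split : ∀ {k} (c : Vec (Fin n) k) j →
                  (∀ i → toℕ i < toℕ j → parity (toℕ (lookup c i)) ≡ 0ℙ) →
                  Σparity c ≡ parity (toℕ (lookup c j)) ⊕ parityAbove c j
  Σparity-split (x ∷ c) zero    _     = refl
  Σparity-split (x ∷ c) (suc j) even< = trans (cong (_⊕ Σparity c) (even< zero (s≤s z≤n)))
    (Σparity-split c j (λ i i<j → even< (suc i) (s≤s i<j)))

  Σparity-updateAt : ∀ {k} (c : Vec (Fin n) k) j {f} →
                     parity (toℕ (f (lookup c j))) ≡ parity (toℕ (lookup c j)) ⁻¹ →
                     Σparity (c [ j ]%= f) ≡ Σparity c ⁻¹
  Σparity-updateAt (x ∷ c) zero    flips =
    trans (cong (_⊕ Σparity c) flips) (⁻¹-distribˡ-⊕ (parity (toℕ x)) (Σparity c))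
  Σparity-updateAt (x ∷ c) (suc j) flips =
    trans (cong (parity (toℕ x) ⊕_) (Σparity-updateAt c j flips))
          (⁻¹-distribʳ-⊕ (parity (toℕ x)) (Σparity c))

  parityAbove-updateAt : ∀ {k} (c : Vec (Fin n) k) {i j f} → toℕ j ≤ toℕ i →
                         parityAbove (c [ j ]%= f) i ≡ parityAbove c i
  parityAbove-updateAt (x ∷ c) {zero}  {zero}  _         = refl
  parityAbove-updateAt (x ∷ c) {suc i} {zero}  _         = refl
  parityAbove-updateAt (x ∷ c) {suc i} {suc j} (s≤s j≤i) = parityAbove-updateAt c j≤i

  module _ {e : Fin n} where
    first≢-∷-≡ : ∀ {k} (c : Vec (Fin n) k) → first≢ e (e ∷ c) ≡ mapM suc (first≢ e c)
    first≢-∷-≡ c with e ≟F e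
    ... | yes _   = refl
    ... | no  e≢e = ⊥-elim (e≢e refl)

    first≢-∷-≢ : ∀ {k x} (c : Vec (Fin n) k) → x ≢ e → first≢ e (x ∷ c) ≡ just zero
    first≢-∷-≢ {x = x} c x≢e with x ≟F e
    ... | yes x≡e = ⊥-elim (x≢e x≡e)
    ... | no  _   = refl

    first≢-nothing-∷ : ∀ {k} x (c : Vec (Fin n) k) → first≢ e (x ∷ c) ≡ nothing →
                       x ≡ e × first≢ e c ≡ nothing
    first≢-nothing-∷ x c h with x ≟F e
    ... | yes x≡e = x≡e , Maybe.map-injective suc-injectiveᶠ h

    first≢-just-suc : ∀ {k j} x (c : Vec (Fin n) k) → first≢ e (x ∷ c) ≡ just (suc j) →
                      x ≡ e × first≢ e c ≡ just j
    first≢-just-suc x c h with x ≟F e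
    ... | yes x≡e = x≡e , Maybe.map-injective suc-injectiveᶠ h

    first≢-just-zero : ∀ {k} x (c : Vec (Fin n) k) → first≢ e (x ∷ c) ≡ just zero → x ≢ e
    first≢-just-zero x c h with x ≟F e
    ... | no x≢e = x≢e
    ... | yes _ with first≢ e c
    first≢-just-zero x c () | yes _ | nothing
    first≢-just-zero x c () | yes _ | just _

    first≢-nothing : ∀ {k} (c : Vec (Fin n) k) → first≢ e c ≡ nothing → ∀ i → lookup c i ≡ e
    first≢-nothing (x ∷ c) h zero    = proj₁ (first≢-nothing-∷ x c h)
    first≢-nothing (x ∷ c) h (suc i) = first≢-nothing c (proj₂ (first≢-nothing-∷ x c h)) i

    first≢-just : ∀ {k j} (c : Vec (Fin n) k) → first≢ e c ≡ just j → lookup c j ≢ e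
    first≢-just {j = zero}  (x ∷ c) h = first≢-just-zero x c h
    first≢-just {j = suc j} (x ∷ c) h = first≢-just c (proj₂ (first≢-just-suc x c h))

    first≢-before : ∀ {k i j} (c : Vec (Fin n) k) → first≢ e c ≡ just j → toℕ i < toℕ j →
                    lookup c i ≡ e
    first≢-before {i = zero}  {suc j} (x ∷ c) h _         = proj₁ (first≢-just-suc x c h)
    first≢-before {i = suc i} {suc j} (x ∷ c) h (s≤s i<j) =
      first≢-before c (proj₂ (first≢-just-suc x c h)) i<j

    first≢-least : ∀ {k i j} (c : Vec (Fin n) k) → first≢ e c ≡ just j → lookup c i ≢ e →
                   toℕ j ≤ toℕ i
    first≢-least c h ci≢e = ≮⇒≥ (ci≢e ∘ first≢-before c h)

module OddHanoi (m' n' : ℕ) {{_ : NonZero m'}} (m'-even : parity m' ≡ 0ℙ) where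
  open ODD m' n'
  open State

  -- Pegs, directions and single steps

  ascending : Parity → Bool
  ascending 0ℙ = true
  ascending 1ℙ = false

  step : Parity → Peg → Peg
  step q = stepPeg (ascending q)

  start : Parity → Peg
  start 0ℙ = zero
  start 1ℙ = fromℕ m'

  end : Parity → Peg
  end q = start (q ⁻¹)

  Interior : Peg → Set
  Interior x = ∀ q → x ≢ start q

  parity-start : ∀ q → parity (toℕ (start q)) ≡ 0ℙ
  parity-start 0ℙ = refl
  parity-start 1ℙ = trans (cong parity (toℕ-fromℕ m')) m'-even

  start-≡ᵇ0 : ∀ q → (toℕ (start q) ≡ᵇ 0) ≡ ascending q
  start-≡ᵇ0 0ℙ = refl
  start-≡ᵇ0 1ℙ = trans (cong (_≡ᵇ 0) (toℕ-fromℕ m')) (nonZero⇒≡ᵇ0-false m')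
    where
    nonZero⇒≡ᵇ0-false : ∀ n → .{{NonZero n}} → (n ≡ᵇ 0) ≡ false
    nonZero⇒≡ᵇ0-false (suc _) = refl

  ≡start⇒⊕-identityˡ : ∀ {x} r q → x ≡ start r → parity (toℕ x) ⊕ q ≡ q
  ≡start⇒⊕-identityˡ r q refl = cong (_⊕ q) (parity-start r)

  toℕ-step-up : ∀ {x} → x ≢ fromℕ m' → toℕ (stepPeg true x) ≡ suc (toℕ x)
  toℕ-step-up {x} x≢m' with toℕ x <? m'
  ... | yes x<m' = toℕ-fromℕ< (s≤s x<m')
  ... | no  x≮m' = ⊥-elim (x≮m' (≤∧≢⇒< (toℕ≤pred[n] x)
                     (λ x≡m' → x≢m' (toℕ-injective (trans x≡m' (sym (toℕ-fromℕ m')))))))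

  toℕ-step-down : ∀ {x} → x ≢ zero → suc (toℕ (stepPeg false x)) ≡ toℕ x
  toℕ-step-down {zero}  x≢0 = ⊥-elim (x≢0 refl)
  toℕ-step-down {suc y} _   = cong suc (toℕ-inject₁ y)

  step-flips-parity : ∀ {x} q → x ≢ end q → parity (toℕ (step q x)) ≡ parity (toℕ x) ⁻¹
  step-flips-parity {x} 0ℙ x≢end = trans (cong parity (toℕ-step-up x≢end)) (parity-suc (toℕ x))
  step-flips-parity {x} 1ℙ x≢end = begin
    parity (toℕ (step 1ℙ x))           ≡⟨ ⁻¹-involutive _ ⟨
    parity (toℕ (step 1ℙ x)) ⁻¹ ⁻¹     ≡⟨ cong _⁻¹ (parity-suc (toℕ (step 1ℙ x))) ⟨
    parity (suc (toℕ (step 1ℙ x))) ⁻¹  ≡⟨ cong (_⁻¹ ∘ parity) (toℕ-step-down x≢end) ⟩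
    parity (toℕ x) ⁻¹                  ∎
    where open ≡-Reasoning

  step-≢ : ∀ {x} q → x ≢ end q → step q x ≢ x
  step-≢ q x≢end y≡x =
    p≢p⁻¹ _ (trans (cong (parity ∘ toℕ) (sym y≡x)) (step-flips-parity q x≢end))

  step-≢-start : ∀ {x} q → x ≢ end q → step q x ≢ start q
  step-≢-start 0ℙ x≢end y≡0 with () ← trans (sym (toℕ-step-up x≢end)) (cong toℕ y≡0)
  step-≢-start {x} 1ℙ x≢end y≡m' = <-irrefl refl (begin-strict
    m'                     ≡⟨ toℕ-fromℕ m' ⟨
    toℕ (fromℕ m')         ≡⟨ cong toℕ y≡m' ⟨
    toℕ (step 1ℙ x)        <⟨ s≤s ≤-refl ⟩
    suc (toℕ (step 1ℙ x))  ≡⟨ toℕ-step-down x≢end ⟩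
    toℕ x                  ≤⟨ toℕ≤pred[n] x ⟩
    m'                     ∎)
    where open ≤-Reasoning

  start-direction : ∀ {x} q r → x ≢ end q → x ≡ start r → q ≡ r
  start-direction 0ℙ 0ℙ _     _       = refl
  start-direction 1ℙ 1ℙ _     _       = refl
  start-direction 0ℙ 1ℙ x≢end x≡start = ⊥-elim (x≢end x≡start)
  start-direction 1ℙ 0ℙ x≢end x≡start = ⊥-elim (x≢end x≡start)

  ≢end-shift : ∀ {x} q → x ≢ end q → x ≢ end (parity (toℕ x) ⊕ q)
  ≢end-shift {x} q x≢end x≡end =
    x≢end (subst (λ r → x ≡ end r)
                 (≡start⇒⊕-identityˡ ((parity (toℕ x) ⊕ q) ⁻¹) q x≡end) x≡end)

  -- x is a digit off end p, q the parity of the digits above it, and p the phase of its tuple.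
  module _ {p q} {x : Peg} (phase : parity (toℕ x) ⊕ q ≡ p) (x≢end : x ≢ end p) where
    movable : x ≢ end q
    movable x≡end = x≢end (subst (λ r → x ≡ end r)
                             (trans (sym (≡start⇒⊕-identityˡ (q ⁻¹) q x≡end)) phase) x≡end)

    step-≢-end : step q x ≢ end p
    step-≢-end y≡end = step-≢-start q movable (trans y≡end (cong start p⁻¹≡q))
      where
      x-odd : parity (toℕ x) ≡ 1ℙ
      x-odd = sym (⁻¹-selfInverse (trans (sym (step-flips-parity q movable))
                (trans (cong (parity ∘ toℕ) y≡end) (parity-start (p ⁻¹)))))
      p⁻¹≡q : p ⁻¹ ≡ q
      p⁻¹≡q = ⁻¹-selfInverse (trans (cong (_⊕ q) (sym x-odd)) phase)

  data StepsToEnd (q : Parity) : Peg → ℕ → Set where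
    arrived : StepsToEnd q (end q) 0
    onward  : ∀ {x k} → x ≢ end q → StepsToEnd q (step q x) k → StepsToEnd q x (suc k)

  stepsToEnd-up : ∀ k {x} → toℕ x + k ≡ m' → StepsToEnd 0ℙ x k
  stepsToEnd-up zero {x} x+0≡m' = subst (λ y → StepsToEnd 0ℙ y 0) (sym x≡m') arrived
    where
    x≡m' : x ≡ fromℕ m'
    x≡m' = toℕ-injective (trans (trans (sym (+-identityʳ _)) x+0≡m') (sym (toℕ-fromℕ m')))
  stepsToEnd-up (suc k) {x} x+k≡m' = onward x≢m'
    (stepsToEnd-up k (trans (cong (_+ k) (toℕ-step-up x≢m')) (trans (sym (+-suc _ k)) x+k≡m')))
    where
    x≢m' : x ≢ fromℕ m'
    x≢m' refl = m+1+n≢m m' (trans (cong (_+ suc k) (sym (toℕ-fromℕ m'))) x+k≡m')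

  stepsToEnd-down : ∀ k {x} → toℕ x ≡ k → StepsToEnd 1ℙ x k
  stepsToEnd-down zero    x≡0   = subst (λ y → StepsToEnd 1ℙ y 0) (sym (toℕ-injective x≡0)) arrived
  stepsToEnd-down (suc k) x≡1+k = onward x≢0
    (stepsToEnd-down k (suc-injective (trans (toℕ-step-down x≢0) x≡1+k)))
    where
    x≢0 : _ ≢ zero
    x≢0 refl = 0≢1+n x≡1+k

  stepsToEnd-start : ∀ q → StepsToEnd q (start q) m'
  stepsToEnd-start 0ℙ = stepsToEnd-up m' refl
  stepsToEnd-start 1ℙ = stepsToEnd-down m' (toℕ-fromℕ m')

  stepsToEnd-down-toℕ : ∀ {x k} → StepsToEnd 1ℙ x k → toℕ x ≡ k
  stepsToEnd-down-toℕ arrived          = refl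
  stepsToEnd-down-toℕ (onward x≢0 r) =
    trans (sym (toℕ-step-down x≢0)) (cong suc (stepsToEnd-down-toℕ r))

  sweep : Parity → List Peg
  sweep q = iterate (step q) (start q) M

  map-toℕ-iterate-up : ∀ {x k} (f : ℕ → ℕ) → StepsToEnd 0ℙ x k →
                       (∀ i → f i ≡ toℕ x + i) →
                       mapL toℕ (iterate (step 0ℙ) x (suc k)) ≡ applyUpTo f (suc k)
  map-toℕ-iterate-up f arrived f≗x+ = cong (_∷ []) (sym (trans (f≗x+ 0) (+-identityʳ _)))
  map-toℕ-iterate-up {x} f (onward x≢end r) f≗x+ =
    cong₂ _∷_ (sym (trans (f≗x+ 0) (+-identityʳ _))) (map-toℕ-iterate-up (f ∘ suc) r λ i →
      trans (f≗x+ (suc i)) (trans (+-suc (toℕ x) i) (cong (_+ i) (sym (toℕ-step-up x≢end)))))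

  map-toℕ-iterate-down : ∀ {x k} → StepsToEnd 1ℙ x k →
                         mapL toℕ (iterate (step 1ℙ) x (suc k)) ≡ downFrom (suc k)
  map-toℕ-iterate-down arrived           = refl
  map-toℕ-iterate-down r@(onward _ r′) =
    cong₂ _∷_ (stepsToEnd-down-toℕ r) (map-toℕ-iterate-down r′)

  allFin≡sweep-up : allFin M ≡ sweep 0ℙ
  allFin≡sweep-up = map-injective toℕ-injective (begin
    mapL toℕ (allFin M)  ≡⟨ map-toℕ-allFin M ⟩
    upTo M               ≡⟨ map-toℕ-iterate-up id (stepsToEnd-start 0ℙ) (λ _ → refl) ⟨
    mapL toℕ (sweep 0ℙ)  ∎)
    where open ≡-Reasoning

  reverse-allFin≡sweep-down : reverse (allFin M) ≡ sweep 1ℙ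
  reverse-allFin≡sweep-down = map-injective toℕ-injective (begin
    mapL toℕ (reverse (allFin M))  ≡⟨ reverse-map toℕ (allFin M) ⟩
    reverse (mapL toℕ (allFin M))  ≡⟨ cong reverse (map-toℕ-allFin M) ⟩
    reverse (upTo M)               ≡⟨ reverse-upTo M ⟩
    downFrom M                     ≡⟨ map-toℕ-iterate-down (stepsToEnd-start 1ℙ) ⟨
    mapL toℕ (sweep 1ℙ)            ∎)
    where open ≡-Reasoning

  -- The successor rule of the reflected Gray code

  advance : ∀ {k} → Vec Peg k → Fin k → Vec Peg k
  advance c j = c [ j ]%= step (parityAbove c j)

  module AdvanceAt {k p} (c : Vec Peg k) {j} (c≡p : Σparity c ≡ p)
                   (hj : first≢ (end p) c ≡ just j) where
    digit-phase : parity (toℕ (lookup c j)) ⊕ parityAbove c j ≡ p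
    digit-phase = trans (sym (Σparity-split c j λ i i<j →
      trans (cong (parity ∘ toℕ) (first≢-before c hj i<j)) (parity-start (p ⁻¹)))) c≡p

    digit-movable : lookup c j ≢ end (parityAbove c j)
    digit-movable = movable {q = parityAbove c j} digit-phase (first≢-just c hj)

    Σparity-advance : Σparity (advance c j) ≡ p ⁻¹
    Σparity-advance =
      trans (Σparity-updateAt c j (step-flips-parity (parityAbove c j) digit-movable)) (cong _⁻¹ c≡p)

  -- GrayFrom p c cs: the successor rule, started at c in phase p, produces exactly cs.
  data GrayFrom {k} : Parity → Vec Peg k → List (Vec Peg k) → Set where
    last : ∀ {p c} → first≢ (end p) c ≡ nothing → GrayFrom p c []
    next : ∀ {p c j c′ cs} → first≢ (end p) c ≡ just j → c′ ≡ advance c j →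
           GrayFrom (p ⁻¹) c′ cs → GrayFrom p c (c′ ∷ cs)

  rephase : ∀ {k p p′} {c : Vec Peg k} {cs} → p ≡ p′ → GrayFrom p c cs → GrayFrom p′ c cs
  rephase refl g = g

  walk-GrayFrom : ∀ {k q x l} {c : Vec Peg k} {cs} → StepsToEnd q x l → Σparity c ≡ q →
                  GrayFrom q (end q ∷ c) cs →
                  GrayFrom (parity (toℕ x) ⊕ q) (x ∷ c)
                    (mapL (_∷ c) (iterate (step q) (step q x) l) ++ cs)
  walk-GrayFrom {q = q} arrived _ g = rephase (sym (≡start⇒⊕-identityˡ (q ⁻¹) q refl)) g
  walk-GrayFrom {q = q} {x} {c = c} (onward x≢end r) c≡q g =
    next (first≢-∷-≢ c (≢end-shift q x≢end)) (cong (λ q′ → step q′ x ∷ c) (sym c≡q))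
      (rephase phase-flips (walk-GrayFrom r c≡q g))
    where
    phase-flips : parity (toℕ (step q x)) ⊕ q ≡ (parity (toℕ x) ⊕ q) ⁻¹
    phase-flips =
      trans (cong (_⊕ q) (step-flips-parity q x≢end)) (⁻¹-distribˡ-⊕ (parity (toℕ x)) q)

  extendReflected : ∀ {k} → Parity → List (Vec Peg k) → List (Vec Peg (suc k))
  extendReflected p []       = []
  extendReflected p (c ∷ cs) = mapL (_∷ c) (sweep p) ++ extendReflected (p ⁻¹) cs

  reflected : (k : ℕ) → List (Vec Peg k)
  reflected zero    = [] ∷ []
  reflected (suc k) = extendReflected 0ℙ (reflected k)

  mutual
    sweep-GrayFrom : ∀ {k q} {c : Vec Peg k} {cs} → Σparity c ≡ q → GrayFrom q c cs →
                     GrayFrom q (start q ∷ c)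
                       (mapL (_∷ c) (iterate (step q) (step q (start q)) m') ++
                        extendReflected (q ⁻¹) cs)
    sweep-GrayFrom {q = q} c≡q g = rephase (≡start⇒⊕-identityˡ q q refl)
      (walk-GrayFrom (stepsToEnd-start q) c≡q (park-GrayFrom c≡q g))

    park-GrayFrom : ∀ {k q} {c : Vec Peg k} {cs} → Σparity c ≡ q → GrayFrom q c cs →
                    GrayFrom q (end q ∷ c) (extendReflected (q ⁻¹) cs)
    park-GrayFrom {c = c} _ (last h) = last (trans (first≢-∷-≡ c) (cong (mapM suc) h))
    park-GrayFrom {c = c} c≡q (next hj refl g) =
      next (trans (first≢-∷-≡ c) (cong (mapM suc) hj)) refl
        (sweep-GrayFrom (AdvanceAt.Σparity-advance c c≡q hj) g)

  Σparity-replicate-zero : ∀ k → Σparity (replicate k (Peg ∋ zero)) ≡ 0ℙ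
  Σparity-replicate-zero zero    = refl
  Σparity-replicate-zero (suc k) = Σparity-replicate-zero k

  reflected-GrayFrom : ∀ k → ∃[ cs ] reflected k ≡ replicate k zero ∷ cs ×
                                     GrayFrom 0ℙ (replicate k zero) cs
  reflected-GrayFrom zero    = [] , refl , last refl
  reflected-GrayFrom (suc k) with reflected-GrayFrom k
  ... | cs , eq , g = _ , cong (extendReflected 0ℙ) eq , sweep-GrayFrom (Σparity-replicate-zero k) g

  map-∷ʳ-reverse : ∀ {k} (c : Vec Peg k) ds →
                   mapL (reverseV c ∷ʳ_) ds ≡ mapL reverseV (mapL (_∷ c) ds)
  map-∷ʳ-reverse c ds = trans (map-cong (λ x → sym (reverse-∷ x c)) ds) (map-∘ ds)

  extendGray-reverse : ∀ {k} p (cs : List (Vec Peg k)) →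
                       extendGray M (ascending p) (mapL reverseV cs) ≡ mapL reverseV (extendReflected p cs)
  extendGray-reverse 0ℙ []       = refl
  extendGray-reverse 1ℙ []       = refl
  extendGray-reverse 0ℙ (c ∷ cs) = begin
    mapL (reverseV c ∷ʳ_) (allFin M) ++ extendGray M false (mapL reverseV cs)
      ≡⟨ cong₂ _++_ (trans (map-∷ʳ-reverse c _)
                      (cong (mapL reverseV ∘ mapL (_∷ c)) allFin≡sweep-up))
                    (extendGray-reverse 1ℙ cs) ⟩
    mapL reverseV (mapL (_∷ c) (sweep 0ℙ)) ++ mapL reverseV (extendReflected 1ℙ cs)
      ≡⟨ map-++ reverseV (mapL (_∷ c) (sweep 0ℙ)) _ ⟨
    mapL reverseV (extendReflected 0ℙ (c ∷ cs)) ∎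
    where open ≡-Reasoning
  extendGray-reverse 1ℙ (c ∷ cs) = begin
    mapL (reverseV c ∷ʳ_) (reverse (allFin M)) ++ extendGray M true (mapL reverseV cs)
      ≡⟨ cong₂ _++_ (trans (map-∷ʳ-reverse c _)
                      (cong (mapL reverseV ∘ mapL (_∷ c)) reverse-allFin≡sweep-down))
                    (extendGray-reverse 0ℙ cs) ⟩
    mapL reverseV (mapL (_∷ c) (sweep 1ℙ)) ++ mapL reverseV (extendReflected 0ℙ cs)
      ≡⟨ map-++ reverseV (mapL (_∷ c) (sweep 1ℙ)) _ ⟨
    mapL reverseV (extendReflected 1ℙ (c ∷ cs)) ∎
    where open ≡-Reasoning

  gray≡reverse-reflected : ∀ k → gray M k ≡ mapL reverseV (reflected k)
  gray≡reverse-reflected zero    = refl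
  gray≡reverse-reflected (suc k) =
    trans (cong (extendGray M true) (gray≡reverse-reflected k)) (extendGray-reverse 0ℙ (reflected k))

  -- States of Algorithm ODD

  module _ (s : State) (d : Disk) (b : Bool) where
    pos-move-self : pos (move s d b) d ≡ stepPeg b (pos s d)
    pos-move-self with d ≟F d
    ... | yes _   = refl
    ... | no d≢d = ⊥-elim (d≢d refl)

    pos-move-other : ∀ {e} → e ≢ d → pos (move s d b) e ≡ pos s e
    pos-move-other {e} e≢d with e ≟F d
    ... | yes e≡d = ⊥-elim (e≢d e≡d)
    ... | no  _   = refl

    dir-move-self : dir (move s d b) d ≡ b
    dir-move-self with d ≟F d
    ... | yes _   = refl
    ... | no d≢d = ⊥-elim (d≢d refl)

    dir-move-other : ∀ {e} → e ≢ d → dir (move s d b) e ≡ dir s e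
    dir-move-other {e} e≢d with e ≟F d
    ... | yes e≡d = ⊥-elim (e≢d e≡d)
    ... | no  _   = refl

    ∈-stack-move-self : d ∈ stack (move s d b) (stepPeg b (pos s d))
    ∈-stack-move-self with stepPeg b (pos s d) ≟F stepPeg b (pos s d)
    ... | yes _   = here refl
    ... | no q≢q = ⊥-elim (q≢q refl)

    ∈-stack-move⁺ : ∀ {e r} → e ≢ d → e ∈ stack s r → e ∈ stack (move s d b) r
    ∈-stack-move⁺ {e} {r} e≢d e∈ with r ≟F pos s d | r ≟F stepPeg b (pos s d)
    ... | yes _ | yes _ = there (∈-filter⁺ (λ x → ¬? (x ≟F d)) e∈ e≢d)
    ... | yes _ | no  _ = ∈-filter⁺ (λ x → ¬? (x ≟F d)) e∈ e≢d
    ... | no  _ | yes _ = there e∈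
    ... | no  _ | no  _ = e∈

    ∈-stack-move⁻ : ∀ {e r} → e ∈ stack (move s d b) r →
                    (e ≡ d × r ≡ stepPeg b (pos s d)) ⊎
                    (e ∈ stack s r × (r ≡ pos s d → e ≢ d))
    ∈-stack-move⁻ {r = r} e∈ with r ≟F pos s d | r ≟F stepPeg b (pos s d)
    ∈-stack-move⁻ (here e≡d) | _      | yes r≡q = inj₁ (e≡d , r≡q)
    ∈-stack-move⁻ (there e∈) | yes _  | yes _   = inj₂ (map₂ const (∈-filter⁻ (λ x → ¬? (x ≟F d)) e∈))
    ∈-stack-move⁻ (there e∈) | no r≢p | yes _   = inj₂ (e∈ , ⊥-elim ∘ r≢p)
    ∈-stack-move⁻ e∈         | yes _  | no _    = inj₂ (map₂ const (∈-filter⁻ (λ x → ¬? (x ≟F d)) e∈))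
    ∈-stack-move⁻ e∈         | no r≢p | no _    = inj₂ (e∈ , ⊥-elim ∘ r≢p)

  record Consistent (s : State) : Set where
    field
      sorted : ∀ r → AllPairs _<ᶠ_ (stack s r)
      ∈⇒pos  : ∀ {d r} → d ∈ stack s r → pos s d ≡ r
      pos⇒∈  : ∀ d → d ∈ stack s (pos s d)
  open Consistent

  move-consistent : ∀ {s d b} → Consistent s → stepPeg b (pos s d) ≢ pos s d →
                    (∀ {e} → pos s e ≡ stepPeg b (pos s d) → d <ᶠ e) →
                    Consistent (move s d b)
  move-consistent {s} {d} {b} cs q≢p d<q =
    record { sorted = sorted′ ; ∈⇒pos = ∈⇒pos′ ; pos⇒∈ = pos⇒∈′ }
    where
    sorted′ : ∀ r → AllPairs _<ᶠ_ (stack (move s d b) r)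
    sorted′ r with r ≟F pos s d | r ≟F stepPeg b (pos s d)
    ... | yes refl | yes r≡q = ⊥-elim (q≢p (sym r≡q))
    ... | yes _    | no  _   = AllPairs.filter⁺ (λ x → ¬? (x ≟F d)) (sorted cs r)
    ... | no  _    | yes refl = All.tabulate (d<q ∘ ∈⇒pos cs) ∷ sorted cs r
    ... | no  _    | no  _   = sorted cs r

    ∈⇒pos′ : ∀ {e r} → e ∈ stack (move s d b) r → pos (move s d b) e ≡ r
    ∈⇒pos′ e∈ with ∈-stack-move⁻ s d b e∈
    ... | inj₁ (refl , r≡q) = trans (pos-move-self s d b) (sym r≡q)
    ... | inj₂ (e∈′ , e≢d) = trans (pos-move-other s d b e≢d′) (∈⇒pos cs e∈′)
      where
      e≢d′ : _ ≢ d
      e≢d′ refl = e≢d (sym (∈⇒pos cs e∈′)) refl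

    pos⇒∈′ : ∀ e → e ∈ stack (move s d b) (pos (move s d b) e)
    pos⇒∈′ e = case e ≟F d of λ where
      (yes refl) → subst (λ r → d ∈ stack (move s d b) r) (sym (pos-move-self s d b))
                     (∈-stack-move-self s d b)
      (no e≢d)   → subst (λ r → e ∈ stack (move s d b) r) (sym (pos-move-other s d b e≢d))
                     (∈-stack-move⁺ s d b e≢d (pos⇒∈ cs e))

  min₂ : Disk → Disk → Disk
  min₂ d e = if toℕ d <ᵇ toℕ e then d else e

  min₂-cases : ∀ d e → (min₂ d e ≡ d × d ≤ᶠ e) ⊎ (min₂ d e ≡ e × e ≤ᶠ d)
  min₂-cases d e with toℕ d <ᵇ toℕ e | <ᵇ-reflects-< (toℕ d) (toℕ e)
  ... | true  | ofʸ d<e = inj₁ (refl , <⇒≤ d<e)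
  ... | false | ofⁿ d≮e = inj₂ (refl , ≮⇒≥ d≮e)

  minDisk-nothing : ∀ {ds} → minDisk ds ≡ nothing → ds ≡ []
  minDisk-nothing {[]}     _ = refl
  minDisk-nothing {d ∷ ds} h with minDisk ds
  minDisk-nothing {d ∷ ds} () | nothing
  minDisk-nothing {d ∷ ds} () | just _

  minDisk-∈ : ∀ {ds e} → minDisk ds ≡ just e → e ∈ ds
  minDisk-∈ {d ∷ ds} h with minDisk ds in eq
  minDisk-∈ {d ∷ ds} refl | nothing = here refl
  minDisk-∈ {d ∷ ds} refl | just e with min₂-cases d e
  ... | inj₁ (m≡d , _) = here m≡d
  ... | inj₂ (m≡e , _) = there (subst (_∈ ds) (sym m≡e) (minDisk-∈ eq))

  minDisk-≤ : ∀ {ds e y} → minDisk ds ≡ just e → y ∈ ds → e ≤ᶠ y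
  minDisk-≤ {d ∷ ds} h y∈ with minDisk ds in eq
  minDisk-≤ {d ∷ ds} refl (here refl) | nothing = ≤-refl
  minDisk-≤ {d ∷ ds} refl (there y∈)  | nothing =
    ⊥-elim (¬Any[] (subst (_ ∈_) (minDisk-nothing eq) y∈))
  minDisk-≤ {d ∷ ds} refl y∈ | just e with min₂-cases d e
  ... | inj₁ (m≡d , d≤e) = subst (_≤ᶠ _) (sym m≡d) (case y∈ of λ where
          (here refl)  → ≤-refl
          (there y∈′) → ≤-trans d≤e (minDisk-≤ eq y∈′))
  ... | inj₂ (m≡e , e≤d) = subst (_≤ᶠ _) (sym m≡e) (case y∈ of λ where
          (here refl)  → e≤d
          (there y∈′) → minDisk-≤ eq y∈′)

  minDisk-least : ∀ {ds x} → x ∈ ds → (∀ {y} → y ∈ ds → x ≤ᶠ y) → minDisk ds ≡ just x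
  minDisk-least {ds} x∈ x≤ with minDisk ds in eq
  ... | nothing with () ← subst (_ ∈_) (minDisk-nothing eq) x∈
  ... | just e = cong just (toℕ-injective (≤-antisym (minDisk-≤ eq x∈) (x≤ (minDisk-∈ eq))))

  -- The peg-wise function of topsWithoutD1 is local to it; unification retrieves it.
  topsWithoutD1-concat : ∀ s → ∃[ top ] topsWithoutD1 s ≡ concat (mapL top (allFin M))
  topsWithoutD1-concat s = _ , refl

  module _ (s : State) where
    private
      top = proj₁ (topsWithoutD1-concat s)

    top-∈⁻ : ∀ {r y} → y ∈ top r → r ≢ pos s zero × y ∈ stack s r
    top-∈⁻ {r} with r ≟F pos s zero | stack s r
    ... | no r≢D₁ | _ ∷ _ = λ { (here refl) → r≢D₁ , here refl }

    top-∈⁺ : ∀ {r x xs} → r ≢ pos s zero → stack s r ≡ x ∷ xs → x ∈ top r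
    top-∈⁺ {r} r≢D₁ with r ≟F pos s zero | stack s r
    ... | yes r≡D₁ | _      = ⊥-elim (r≢D₁ r≡D₁)
    ... | no  _    | _ ∷ _ = λ { refl → here refl }

    tops-∈⁻ : Consistent s → ∀ {y} → y ∈ topsWithoutD1 s → pos s y ≢ pos s zero
    tops-∈⁻ cs y∈ with ∈-concat⁻′ (mapL top (allFin M)) y∈
    ... | ys , y∈ys , ys∈ with ∈-map⁻ top ys∈
    ...   | r , _ , refl with top-∈⁻ y∈ys
    ...     | r≢D₁ , y∈r = r≢D₁ ∘ trans (sym (∈⇒pos cs y∈r))

    tops-∈⁺ : Consistent s → ∀ {x} → pos s x ≢ pos s zero →
              (∀ {e} → pos s e ≡ pos s x → x ≤ᶠ e) → x ∈ topsWithoutD1 s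
    tops-∈⁺ cs {x} x≢D₁ x≤
      with sorted-minimum-head (sorted cs (pos s x)) (pos⇒∈ cs x) (x≤ ∘ ∈⇒pos cs)
    ... | _ , stack≡ = ∈-concat⁺′ (top-∈⁺ x≢D₁ stack≡) (∈-map⁺ top (∈-allFin (pos s x)))

    smallest-off-D₁ : Consistent s → ∀ {x} → pos s x ≢ pos s zero →
                      (∀ {e} → pos s e ≢ pos s zero → x ≤ᶠ e) →
                      minDisk (topsWithoutD1 s) ≡ just x
    smallest-off-D₁ cs x≢D₁ x≤ =
      minDisk-least (tops-∈⁺ cs x≢D₁ (λ e≡x → x≤ (x≢D₁ ∘ trans (sym e≡x))))
                    (x≤ ∘ tops-∈⁻ cs)

    all-on-D₁ : Consistent s → (∀ e → pos s e ≡ pos s zero) →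
                minDisk (topsWithoutD1 s) ≡ nothing
    all-on-D₁ cs on with minDisk (topsWithoutD1 s) in eq
    ... | nothing = refl
    ... | just e  = ⊥-elim (tops-∈⁻ cs (minDisk-∈ eq) (on e))

  dirFor-spec : ∀ s d {δ} → (∀ r → pos s d ≡ start r → δ ≡ ascending r) →
                (Interior (pos s d) → dir s d ≡ δ) → dirFor s d ≡ δ
  dirFor-spec s d at-start inside with toℕ (pos s d) ≡ᵇ 0 in at0 | toℕ (pos s d) ≡ᵇ m' in atm'
  ... | true  | _    = sym (at-start 0ℙ (toℕ-injective (≡ᵇ⇒≡ _ 0 (subst T (sym at0) tt))))
  ... | false | true = sym (at-start 1ℙ (toℕ-injective
                         (trans (≡ᵇ⇒≡ _ m' (subst T (sym atm') tt)) (sym (toℕ-fromℕ m')))))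
  ... | false | false = inside λ where
    0ℙ d≡0  → subst T at0 (≡⇒≡ᵇ _ 0 (cong toℕ d≡0))
    1ℙ d≡m' → subst T atm' (≡⇒≡ᵇ _ m' (trans (cong toℕ d≡m') (toℕ-fromℕ m')))

  record Config (x : Peg) (c : Vec Peg n') (s : State) : Set where
    field
      pos-D₁     : pos s zero ≡ x
      pos-rest   : ∀ j → pos s (suc j) ≡ lookup c j
      consistent : Consistent s
      dir-rest   : ∀ j → Interior (lookup c j) → dir s (suc j) ≡ ascending (parityAbove c j)
  open Config

  tuple-config : ∀ {x c s} → Config x c s → tuple s ≡ reverseV (x ∷ c)
  tuple-config {c = c} conf =
    cong reverseV (cong₂ _∷_ (pos-D₁ conf)
      (trans (tabulate-cong (pos-rest conf)) (tabulate∘lookup c)))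

  moveD₁-config : ∀ {x c s b} → Config x c s → stepPeg b x ≢ x →
                  Config (stepPeg b x) c (move s zero b)
  moveD₁-config {x} {c} {s} {b} conf y≢x = record
    { pos-D₁     = trans (pos-move-self s zero b) (cong (stepPeg b) (pos-D₁ conf))
    ; pos-rest   = λ j → trans (pos-move-other s zero b (λ ())) (pos-rest conf j)
    ; consistent = move-consistent (consistent conf) (y≢x ∘ at-x) D₁<
    ; dir-rest   = λ j int → trans (dir-move-other s zero b (λ ())) (dir-rest conf j int)
    }
    where
    at-x : stepPeg b (pos s zero) ≡ pos s zero → stepPeg b x ≡ x
    at-x = subst (λ z → stepPeg b z ≡ z) (pos-D₁ conf)
    D₁< : ∀ {e} → pos s e ≡ stepPeg b (pos s zero) → 0 < toℕ e
    D₁< {zero}  e≡q = ⊥-elim (y≢x (at-x (sym e≡q)))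
    D₁< {suc _} _   = s≤s z≤n

  walk-config : ∀ {q x k c s} → StepsToEnd q x k → Config x c s →
                proj₁ (walk k (ascending q) s) ≡
                  mapL (λ y → reverseV (y ∷ c)) (iterate (step q) (step q x) k) ×
                Config (end q) c (proj₂ (walk k (ascending q) s))
  walk-config arrived conf = refl , conf
  walk-config {q} (onward x≢end r) conf =
    let conf′        = moveD₁-config {b = ascending q} conf (step-≢ q x≢end)
        xs≡ , conf″ = walk-config r conf′
    in cong₂ _∷_ (tuple-config conf′) xs≡ , conf″

  module Settled {p c s} (conf : Config (end p) c s) (c≡p : Σparity c ≡ p) where
    on-D₁ : ∀ {i} → lookup c i ≡ end p → pos s (suc i) ≡ pos s zero
    on-D₁ {i} ci≡end = trans (pos-rest conf i) (trans ci≡end (sym (pos-D₁ conf)))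

    none-off : first≢ (end p) c ≡ nothing → minDisk (topsWithoutD1 s) ≡ nothing
    none-off h = all-on-D₁ s (consistent conf) λ where
      zero    → refl
      (suc i) → on-D₁ (first≢-nothing c h i)

    module _ {j} (hj : first≢ (end p) c ≡ just j) where
      open AdvanceAt c c≡p hj

      least-off : ∀ {e} → pos s e ≢ end p → suc j ≤ᶠ e
      least-off {zero}  e≢end = ⊥-elim (e≢end (pos-D₁ conf))
      least-off {suc i} e≢end = s≤s (first≢-least c hj (e≢end ∘ trans (pos-rest conf i)))

      first-off : minDisk (topsWithoutD1 s) ≡ just (suc j)
      first-off = smallest-off-D₁ s (consistent conf)
        (λ eq → first≢-just c hj (trans (sym (pos-rest conf j)) (trans eq (pos-D₁ conf))))
        (λ e≢D₁ → least-off (e≢D₁ ∘ flip trans (sym (pos-D₁ conf))))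

      dirFor-digit : dirFor s (suc j) ≡ ascending (parityAbove c j)
      dirFor-digit = dirFor-spec s (suc j)
        (λ r at-start → cong ascending
           (start-direction _ r digit-movable (trans (sym (pos-rest conf j)) at-start)))
        (λ int → dir-rest conf j (subst Interior (pos-rest conf j) int))

      advance-config : Config (end p) (advance c j) (move s (suc j) (dirFor s (suc j)))
      advance-config rewrite dirFor-digit = record
        { pos-D₁     = trans (pos-move-other s (suc j) δ (λ ())) (pos-D₁ conf)
        ; pos-rest   = pos-rest′
        ; consistent = move-consistent (consistent conf) (step-≢ q digit-movable ∘ at-digit) digit<
        ; dir-rest   = dir-rest′
        }
        where
        q = parityAbove c j
        δ = ascending q
        x = lookup c j
        at-digit : stepPeg δ (pos s (suc j)) ≡ pos s (suc j) → step q x ≡ x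
        at-digit = subst (λ z → step q z ≡ z) (pos-rest conf j)
        pos-rest′ : ∀ i → pos (move s (suc j) δ) (suc i) ≡ lookup (advance c j) i
        pos-rest′ i = case i ≟F j of λ where
          (yes refl) → trans (pos-move-self s (suc j) δ)
                         (trans (cong (step q) (pos-rest conf j)) (sym (lookup∘updateAt j c)))
          (no i≢j)   → trans (pos-move-other s (suc j) δ (i≢j ∘ suc-injectiveᶠ))
                         (trans (pos-rest conf i) (sym (lookup∘updateAt′ i j i≢j c)))
        digit< : ∀ {e} → pos s e ≡ stepPeg δ (pos s (suc j)) → suc j <ᶠ e
        digit< {e} e≡ = ≤∧≢⇒< (least-off lands-off-D₁) λ j≡e → step-≢ q digit-movable
          (sym (trans (sym (pos-rest conf j)) (trans (cong (pos s) (toℕ-injective j≡e)) lands)))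
          where
          lands : pos s e ≡ step q x
          lands = trans e≡ (cong (step q) (pos-rest conf j))
          lands-off-D₁ : pos s e ≢ end p
          lands-off-D₁ = step-≢-end digit-phase (first≢-just c hj) ∘ trans (sym lands)
        dir-rest′ : ∀ i → Interior (lookup (advance c j) i) →
                    dir (move s (suc j) δ) (suc i) ≡ ascending (parityAbove (advance c j) i)
        dir-rest′ i int = case i ≟F j of λ where
          (yes refl) → trans (dir-move-self s (suc j) δ)
                         (cong ascending (sym (parityAbove-updateAt c ≤-refl)))
          (no i≢j)   → let int′ = subst Interior (lookup∘updateAt′ i j i≢j c) int in
            trans (dir-move-other s (suc j) δ (i≢j ∘ suc-injectiveᶠ))
              (trans (dir-rest conf i int′)
                (cong ascending (sym (parityAbove-updateAt c (first≢-least c hj (int′ (p ⁻¹)))))))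

  -- Rounds of Algorithm ODD

  sweep-recorded : ∀ {p c s} → Config (start p) c s →
                   let w = walk m' (toℕ (pos s zero) ≡ᵇ 0) s in
                   tuple s ∷ proj₁ w ≡ mapL reverseV (mapL (_∷ c) (sweep p)) ×
                   Config (end p) c (proj₂ w)
  sweep-recorded {p} {c} {s} conf
    rewrite cong (λ y → toℕ y ≡ᵇ 0) (pos-D₁ conf) | start-≡ᵇ0 p
    with walk-config (stepsToEnd-start p) conf
  ... | xs≡ , conf′ = cong₂ _∷_ (tuple-config conf) (trans xs≡ (map-∘ _)) , conf′

  round : ∀ {p c s cs} → Config (start p) c s → Σparity c ≡ p → GrayFrom p c cs →
          mapM (tuple s ∷_) (loop (suc (length cs)) s) ≡
            just (mapL reverseV (extendReflected p (c ∷ cs)))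
  round {p} {c} {s} conf c≡p (last h)
    with walk m' (toℕ (pos s zero) ≡ᵇ 0) s | sweep-recorded {p} conf
  ... | xs , s₁ | recorded , conf₁
    with minDisk (topsWithoutD1 s₁) | Settled.none-off conf₁ c≡p h
  ... | .nothing | refl =
    cong just (trans recorded (cong (mapL reverseV) (sym (++-identityʳ (mapL (_∷ c) (sweep p))))))
  round {p} {c} {s} conf c≡p (next {j = j} {cs = cs} hj refl g)
    with walk m' (toℕ (pos s zero) ≡ᵇ 0) s | sweep-recorded {p} conf
  ... | xs , s₁ | recorded , conf₁
    with minDisk (topsWithoutD1 s₁) | Settled.first-off conf₁ c≡p hj
  ... | .(just (suc j)) | refl = begin
    mapM (tuple s ∷_) (mapM (λ ys → xs ++ tuple s₂ ∷ ys) (loop (suc (length cs)) s₂))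
      ≡⟨ Maybe.map-∘ (loop (suc (length cs)) s₂) ⟨
    mapM (λ ys → tuple s ∷ xs ++ tuple s₂ ∷ ys) (loop (suc (length cs)) s₂)
      ≡⟨ Maybe.map-∘ (loop (suc (length cs)) s₂) ⟩
    mapM ((tuple s ∷ xs) ++_) (mapM (tuple s₂ ∷_) (loop (suc (length cs)) s₂))
      ≡⟨ cong (mapM ((tuple s ∷ xs) ++_))
           (round (Settled.advance-config conf₁ c≡p hj) (AdvanceAt.Σparity-advance c c≡p hj) g) ⟩
    just ((tuple s ∷ xs) ++ mapL reverseV (extendReflected (p ⁻¹) (advance c j ∷ cs)))
      ≡⟨ cong just (trans (cong (_++ mapL reverseV (extendReflected (p ⁻¹) (advance c j ∷ cs)))
                                recorded)
                          (sym (map-++ reverseV (mapL (_∷ c) (sweep p)) _))) ⟩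
    just (mapL reverseV (extendReflected p (c ∷ advance c j ∷ cs))) ∎
    where
    open ≡-Reasoning
    s₂ = move s₁ (suc j) (dirFor s₁ (suc j))

  initial-config : Config zero (replicate n' zero) initial
  initial-config = record
    { pos-D₁     = refl
    ; pos-rest   = λ j → sym (lookup-replicate j zero)
    ; consistent = record
      { sorted = λ { zero → AllPairs.tabulate⁺-< id ; (suc _) → [] }
      ; ∈⇒pos  = λ { {r = zero} _ → refl ; {r = suc _} () }
      ; pos⇒∈  = ∈-allFin
      }
    ; dir-rest   = λ j int → ⊥-elim (int 0ℙ (lookup-replicate j zero))
    }

  run-gray : ∃[ fuel ] run fuel ≡ just (gray M N)
  run-gray with reflected-GrayFrom n'
  ... | cs , reflected≡ , g = suc (length cs) , (begin
    mapM (tuple initial ∷_) (loop (suc (length cs)) initial)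
      ≡⟨ round initial-config (Σparity-replicate-zero n') g ⟩
    just (mapL reverseV (extendReflected 0ℙ (replicate n' zero ∷ cs)))
      ≡⟨ cong (just ∘ mapL reverseV ∘ extendReflected 0ℙ) reflected≡ ⟨
    just (mapL reverseV (reflected N))
      ≡⟨ cong just (gray≡reverse-reflected N) ⟨
    just (gray M N) ∎)
    where open ≡-Reasoning

theorem1 : (m n : ℕ) → 3 ≤ m → m % 2 ≡ 1 → 1 ≤ n →
    ∃[ fuel ] oddRun m n fuel ≡ just (gray m n)
theorem1 (suc m') (suc n') (s≤s (s≤s (s≤s _))) m-odd _ =
  OddHanoi.run-gray m' n' (suc%2≡1⇒parity≡0ℙ m' m-odd)
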